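{- For every $n\ge1$ and every $i\in\{1,\dots,n\}$, the set $\mathcal G^{(+,\dots,+,-,\dots,-)}$, indexed by the word consisting of $i$ letters $+$ followed by $n-i$ letters $-$, contains exactly one ladder (of degree $n$).
   Context: A ladder is a rooted tree in which every vertex that is not a leaf has exactly one child. An ordered forest of degree $n$ is a planar rooted forest (left-to-right sequence of rooted trees, children of each vertex linearly ordered left to right) with $n$ vertices together with a bijection from its vertex set to $\{1,\dots,n\}$ (labels); edges point towards roots; $\bullet_1$ is the one-vertex tree. For $n\ge1$ and $\underline\varepsilon=(\varepsilon_1,\dots,\varepsilon_n)\in\{+,-\}^n$ define sets $\mathcal G^{(\underline\varepsilon)}$ of ordered forests of degree $n$ recursively: $\mathcal G^{(\varepsilon_1)}=\{\bullet_1\}$; for $n\ge2$, let $F'$ range over $\mathcal G^{(\varepsilon_1,\dots,\varepsilon_{n-1})}$ with trees $T_1,\dots,T_m$ from left to right; all vertices of $F'$ keep their labels and a new vertex labelled $n$ is added. If $\varepsilon_n=-$: add a new root whose children are the roots of $T_1,\dots,T_m$ in order. If $\varepsilon_n=+$: either add the new vertex as a one-vertex tree at the right end, or, for some $1\le i\le m$, attach the new vertex as rightmost child of the root of $T_i$ and make the roots of $T_{i+1},\dots,T_m$ (in order) the children of the new vertex. -}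

module Defs where

open import Data.Nat using (ℕ; suc)
open import Data.List using (List; []; _∷_; _++_; map; concatMap; [_])
open import Data.Product using (∃-syntax; _×_)
open import Relation.Binary.PropositionalEquality using (_≡_)

data Sign : Set where
  plus minus : Sign

data Tree : Set where
  node : ℕ → List Tree → Tree

Forest : Set
Forest = List Tree

-- Attaching new vertex n as rightmost child of the root of T_i,
-- with T_{i+1},...,T_m becoming its children (one result per i = 1..m).
attachAt : ℕ → Forest → List Forest
attachAt n [] = []
attachAt n (node l cs ∷ ts) =
  (node l (cs ++ [ node n ts ]) ∷ []) ∷ map (node l cs ∷_) (attachAt n ts)

step : Sign → ℕ → Forest → List Forest
step minus n F = [ [ node n F ] ]
step plus  n F = (F ++ [ node n [] ]) ∷ attachAt n F

go : ℕ → List Forest → List Sign → List Forest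
go k Fs [] = Fs
go k Fs (e ∷ w) = go (suc k) (concatMap (step e k) Fs) w

-- G^(ε) for a nonempty word ε (given as a list, first letter first);
-- the empty word gives the empty collection (unused).
G : List Sign → List Forest
G [] = []
G (e ∷ w) = go 2 [ [ node 1 [] ] ] w

data IsLadderTree : Tree → Set where
  leaf : ∀ {l} → IsLadderTree (node l [])
  one  : ∀ {l t} → IsLadderTree t → IsLadderTree (node l (t ∷ []))

IsLadder : Forest → Set
IsLadder F = ∃[ t ] (F ≡ (t ∷ []) × IsLadderTree t)

-- After the i plus-steps, every forest is a row of one-vertex trees followed
-- by at most one ladder, and each such row-and-ladder shape with the right
-- number of vertices occurs exactly once: the last vertex is either a new
-- rightmost leaf or was attached to the last one-vertex tree, and the shape
-- decides which, so the predecessor and its shape are determined.  Each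
-- minus-step puts a new root above the whole forest, which is a ladder
-- exactly when the forest before it was empty or a single ladder; hence the
-- unique ladder among the plus-forests yields the unique ladder at the end.
module Submission where

open import Defs
open import Data.Nat using (ℕ; zero; suc; _+_; _≤_; _∸_; s≤s; z≤n)
open import Data.Nat.Properties using (+-suc; +-identityʳ)
open import Data.List using (List; []; _∷_; _++_; map; concatMap; [_]; replicate)
open import Data.List.Properties using (map-id; map-∘; concatMap-map; concatMap-pure)
open import Data.List.Relation.Unary.Any using (here; there)
open import Data.List.Membership.Propositional using (_∈_; find; lose)
open import Data.List.Membership.Propositional.Properties
  using (∈-map⁺; ∈-map⁻; ∈-concatMap⁺; ∈-concatMap⁻)
open import Data.Product using (∃-syntax; _×_; _,_)
open import Data.Sum using (_⊎_; inj₁; inj₂)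
open import Data.Empty using (⊥; ⊥-elim)
open import Relation.Binary.PropositionalEquality using (_≡_; refl; sym; trans; cong; module ≡-Reasoning)
open import Function using (_∘_)

plusForests : ℕ → List Forest
plusForests zero    = [ [ node 1 [] ] ]
plusForests (suc m) = concatMap (step plus (suc (suc m))) (plusForests m)

go-plus : ∀ j m w →
  go (suc (suc m)) (plusForests m) (replicate j plus ++ w) ≡
  go (suc (suc (j + m))) (plusForests (j + m)) w
go-plus zero    m w = refl
go-plus (suc j) m w rewrite go-plus j (suc m) w | +-suc j m = refl

addRoots : ℕ → ℕ → Forest → Forest
addRoots k zero    F = F
addRoots k (suc d) F = addRoots (suc k) d [ node k F ]

go-minus : ∀ d k Fs → go k Fs (replicate d minus) ≡ map (addRoots k d) Fs
go-minus zero    k Fs = sym (map-id Fs)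
go-minus (suc d) k Fs = begin
  go (suc k) (concatMap (step minus k) Fs) (replicate d minus)
    ≡⟨ go-minus d (suc k) _ ⟩
  map (addRoots (suc k) d) (concatMap ([_] ∘ newRoot) Fs)
    ≡⟨ cong (map (addRoots (suc k) d)) (sym (concatMap-map [_] newRoot Fs)) ⟩
  map (addRoots (suc k) d) (concatMap [_] (map newRoot Fs))
    ≡⟨ cong (map (addRoots (suc k) d)) (concatMap-pure (map newRoot Fs)) ⟩
  map (addRoots (suc k) d) (map newRoot Fs)
    ≡⟨ sym (map-∘ Fs) ⟩
  map (addRoots k (suc d)) Fs
    ∎
  where
  open ≡-Reasoning
  newRoot : Forest → Forest
  newRoot F = [ node k F ]

G-plus-minus : ∀ j d →
  G (replicate (suc j) plus ++ replicate d minus) ≡ map (addRoots (suc (suc j)) d) (plusForests j)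
G-plus-minus j d rewrite go-plus j 0 (replicate d minus) | +-identityʳ j =
  go-minus d (suc (suc j)) (plusForests j)

data Ladder : ℕ → Tree → Set where
  leaf : ∀ {l} → Ladder 0 (node l [])
  one  : ∀ {h l t} → Ladder h t → Ladder (suc h) (node l [ t ])

IsLadderTree⇒Ladder : ∀ {t} → IsLadderTree t → ∃[ h ] Ladder h t
IsLadderTree⇒Ladder leaf = 0 , leaf
IsLadderTree⇒Ladder (one p) = let h , q = IsLadderTree⇒Ladder p in suc h , one q

Ladder⇒IsLadderTree : ∀ {h t} → Ladder h t → IsLadderTree t
Ladder⇒IsLadderTree leaf    = leaf
Ladder⇒IsLadderTree (one p) = one (Ladder⇒IsLadderTree p)

-- Shape r h F: F is r one-vertex trees followed by a ladder with h vertices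
-- (no ladder when h = 0).  Such an F has h + r vertices.
data Shape : ℕ → ℕ → Forest → Set where
  []     : Shape 0 0 []
  ladder : ∀ {h t} → Ladder h t → Shape 0 (suc h) [ t ]
  leaf∷_ : ∀ {r h l F} → Shape r h F → Shape (suc r) h (node l [] ∷ F)

IsLadder⇒Shape : ∀ {F} → IsLadder F → ∃[ h ] Shape 0 h F
IsLadder⇒Shape (t , refl , p) = let h , q = IsLadderTree⇒Ladder p in suc h , ladder q

Shape⇒IsLadder : ∀ {h F} → Shape 0 (suc h) F → IsLadder F
Shape⇒IsLadder (ladder p) = _ , refl , Ladder⇒IsLadderTree p

addRoots-IsLadder⁺ : ∀ d k {F} → IsLadder F → IsLadder (addRoots k d F)
addRoots-IsLadder⁺ zero    k p              = p
addRoots-IsLadder⁺ (suc d) k (t , refl , p) = addRoots-IsLadder⁺ d (suc k) (_ , refl , one p)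

addRoots-IsLadder⁻ : ∀ d k F → IsLadder (addRoots k d F) → ∃[ h ] Shape 0 h F
addRoots-IsLadder⁻ zero    k F p = IsLadder⇒Shape p
addRoots-IsLadder⁻ (suc d) k F p with addRoots-IsLadder⁻ d (suc k) _ p
... | _ , ladder leaf    = 0 , []
... | _ , ladder (one q) = _ , ladder q

shape-append-leaf⁻ : ∀ {r h k} F → Shape r h (F ++ [ node k [] ]) →
  (h ≡ 0 × ∃[ r′ ] (r ≡ suc r′ × Shape r′ 0 F)) ⊎ (h ≡ 1 × Shape r 0 F)
shape-append-leaf⁻ []          (ladder leaf)       = inj₂ (refl , [])
shape-append-leaf⁻ []          (leaf∷ [])          = inj₁ (refl , 0 , refl , [])
shape-append-leaf⁻ (_ ∷ [])    (leaf∷ ladder leaf) = inj₂ (refl , leaf∷ [])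
shape-append-leaf⁻ (_ ∷ [])    (leaf∷ leaf∷ [])    = inj₁ (refl , 1 , refl , leaf∷ [])
shape-append-leaf⁻ (_ ∷ G ∷ F) (leaf∷ p) with shape-append-leaf⁻ (G ∷ F) p
... | inj₁ (refl , r′ , refl , q) = inj₁ (refl , suc r′ , refl , leaf∷ q)
... | inj₂ (refl , q)             = inj₂ (refl , leaf∷ q)

[]∉attachAt : ∀ {k F} → [] ∈ attachAt k F → ⊥
[]∉attachAt {F = node l cs ∷ F} (there p) with ∈-map⁻ (node l cs ∷_) p
... | _ , _ , ()

-- The new vertex can only have gone below the last one-vertex tree, with
-- the ladder (if any) hanging below it.
shape-attach⁻ : ∀ {k F X r h} → X ∈ attachAt k F → Shape r h X →
  ∃[ h′ ] (h ≡ suc (suc h′) × Shape (suc r) h′ F)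
shape-attach⁻ {F = node l [] ∷ []}     (here refl) (ladder (one leaf))    = 0 , refl , leaf∷ []
shape-attach⁻ {F = node l [] ∷ _ ∷ []} (here refl) (ladder (one (one q))) = _ , refl , leaf∷ ladder q
shape-attach⁻ {F = node l [] ∷ _ ∷ _ ∷ _}   (here refl) (ladder (one ()))
shape-attach⁻ {F = node l (_ ∷ []) ∷ _}     (here refl) (ladder ())
shape-attach⁻ {F = node l (_ ∷ _ ∷ _) ∷ _}  (here refl) (ladder ())
shape-attach⁻ {F = node l cs ∷ F} (there p) s with ∈-map⁻ (node l cs ∷_) p
shape-attach⁻ (there p) (ladder _) | X , X∈ , refl = ⊥-elim ([]∉attachAt X∈)
shape-attach⁻ (there p) (leaf∷ q)  | X , X∈ , refl =
  let h′ , e , q′ = shape-attach⁻ X∈ q in h′ , e , leaf∷ q′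

shape-size : ∀ {m F r h} → F ∈ plusForests m → Shape r h F → h + r ≡ suc m
shape-size {zero} (here refl) (leaf∷ [])    = refl
shape-size {zero} (here refl) (ladder leaf) = refl
shape-size {suc m} p s with find (∈-concatMap⁻ (step plus (suc (suc m))) {plusForests m} p)
... | F , F∈ , here refl with shape-append-leaf⁻ F s
...   | inj₁ (refl , _ , refl , q) = cong suc (shape-size F∈ q)
...   | inj₂ (refl , q)            = cong suc (shape-size F∈ q)
shape-size {suc m} {r = r} p s | F , F∈ , there X∈ with shape-attach⁻ X∈ s
... | h′ , refl , q = cong suc (trans (sym (+-suc h′ r)) (shape-size F∈ q))

attachAt-shape-unique : ∀ {k F X Y r h} → X ∈ attachAt k F → Y ∈ attachAt k F →
  Shape r h X → Shape r h Y → X ≡ Y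
attachAt-shape-unique {F = node _ _ ∷ _} (here refl) (here refl) _ _ = refl
attachAt-shape-unique {F = node l cs ∷ _} (here refl) (there q) s t with ∈-map⁻ (node l cs ∷_) q
attachAt-shape-unique (here refl) (there q) s (ladder _) | _ , Y∈ , refl = ⊥-elim ([]∉attachAt Y∈)
attachAt-shape-unique {F = node l cs ∷ _} (there p) (here refl) s t =
  sym (attachAt-shape-unique (here refl) (there p) t s)
attachAt-shape-unique {F = node l cs ∷ _} (there p) (there q) s t
  with ∈-map⁻ (node l cs ∷_) p | ∈-map⁻ (node l cs ∷_) q
... | _ , X∈ , refl | _ , Y∈ , refl with s | t
...   | ladder _ | _        = ⊥-elim ([]∉attachAt X∈)
...   | leaf∷ s′ | leaf∷ t′ = cong (node l [] ∷_) (attachAt-shape-unique X∈ Y∈ s′ t′)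

plusForests-shape-unique : ∀ {m F G r h} → F ∈ plusForests m → G ∈ plusForests m →
  Shape r h F → Shape r h G → F ≡ G
plusForests-shape-unique {zero} (here refl) (here refl) _ _ = refl
plusForests-shape-unique {suc m} p q s t
  with find (∈-concatMap⁻ (step plus (suc (suc m))) {plusForests m} p)
     | find (∈-concatMap⁻ (step plus (suc (suc m))) {plusForests m} q)
... | F , F∈ , here refl | G , G∈ , here refl
  with shape-append-leaf⁻ F s | shape-append-leaf⁻ G t
...   | inj₁ (refl , _ , refl , s′) | inj₁ (_ , _ , refl , t′) =
        cong (_++ _) (plusForests-shape-unique {m} F∈ G∈ s′ t′)
...   | inj₂ (refl , s′)            | inj₂ (_ , t′)            =
        cong (_++ _) (plusForests-shape-unique {m} F∈ G∈ s′ t′)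
...   | inj₁ (refl , _)             | inj₂ (() , _)
...   | inj₂ (refl , _)             | inj₁ (() , _)
plusForests-shape-unique {suc m} p q s t | F , _ , here refl | _ , _ , there Y∈
  with shape-append-leaf⁻ F s | shape-attach⁻ Y∈ t
...   | inj₁ (refl , _) | _ , () , _
...   | inj₂ (refl , _) | _ , () , _
plusForests-shape-unique {suc m} p q s t | _ , _ , there X∈ | G , _ , here refl
  with shape-attach⁻ X∈ s | shape-append-leaf⁻ G t
...   | _ , refl , _ | inj₁ (() , _)
...   | _ , refl , _ | inj₂ (() , _)
plusForests-shape-unique {suc m} p q s t | _ , F∈ , there X∈ | _ , G∈ , there Y∈
  with shape-attach⁻ X∈ s | shape-attach⁻ Y∈ t
...   | _ , refl , s′ | _ , refl , t′
  with refl ← plusForests-shape-unique {m} F∈ G∈ s′ t′ = attachAt-shape-unique X∈ Y∈ s t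

shape-append-leaf⁺ : ∀ {r k F} → Shape r 0 F → Shape (suc r) 0 (F ++ [ node k [] ])
shape-append-leaf⁺ []        = leaf∷ []
shape-append-leaf⁺ (leaf∷ s) = leaf∷ shape-append-leaf⁺ s

shape-append-ladder⁺ : ∀ {r k F} → Shape r 0 F → Shape r 1 (F ++ [ node k [] ])
shape-append-ladder⁺ []        = ladder leaf
shape-append-ladder⁺ (leaf∷ s) = leaf∷ shape-append-ladder⁺ s

shape-attach⁺ : ∀ {k r h F} → Shape (suc r) h F →
  ∃[ X ] (X ∈ attachAt k F × Shape r (suc (suc h)) X)
shape-attach⁺ {r = zero}  (leaf∷ [])         = _ , here refl , ladder (one leaf)
shape-attach⁺ {r = zero}  (leaf∷ ladder s)   = _ , here refl , ladder (one (one s))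
shape-attach⁺ {r = suc r} (leaf∷_ {l = l} s) =
  let X , X∈ , s′ = shape-attach⁺ s in _ , there (∈-map⁺ (node l [] ∷_) X∈) , leaf∷ s′

plusForests-shape-exists : ∀ m r h → h + r ≡ suc m → ∃[ F ] (F ∈ plusForests m × Shape r h F)
plusForests-shape-exists zero    _ zero          refl = _ , here refl , leaf∷ []
plusForests-shape-exists zero    _ (suc zero)    refl = _ , here refl , ladder leaf
plusForests-shape-exists (suc m) _ zero          refl =
  let F , F∈ , s = plusForests-shape-exists m (suc m) 0 refl
  in _ , ∈-concatMap⁺ (step plus (suc (suc m))) (lose F∈ (here refl)) , shape-append-leaf⁺ s
plusForests-shape-exists (suc m) _ (suc zero)    refl =
  let F , F∈ , s = plusForests-shape-exists m (suc m) 0 refl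
  in _ , ∈-concatMap⁺ (step plus (suc (suc m))) (lose F∈ (here refl)) , shape-append-ladder⁺ s
plusForests-shape-exists (suc m) r (suc (suc h)) refl =
  let F , F∈ , s = plusForests-shape-exists m (suc r) h (+-suc h r)
      X , X∈ , s′ = shape-attach⁺ s
  in X , ∈-concatMap⁺ (step plus (suc (suc m))) (lose F∈ (there X∈)) , s′

mainTheorem5 : (n i : ℕ) → 1 ≤ i → i ≤ n →
    ∃[ F ] (F ∈ G (replicate i plus ++ replicate (n ∸ i) minus) × IsLadder F
      × (∀ F′ → F′ ∈ G (replicate i plus ++ replicate (n ∸ i) minus) → IsLadder F′ → F′ ≡ F))
mainTheorem5 n (suc j) (s≤s z≤n) _ rewrite G-plus-minus j (n ∸ suc j)
  with F₀ , F₀∈ , s₀ ← plusForests-shape-exists j 0 (suc j) (cong suc (+-identityʳ j)) =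
  addRoots k d F₀ , ∈-map⁺ (addRoots k d) F₀∈ , addRoots-IsLadder⁺ d k (Shape⇒IsLadder s₀) , unique
  where
  k d : ℕ
  k = suc (suc j)
  d = n ∸ suc j
  unique : ∀ F′ → F′ ∈ map (addRoots k d) (plusForests j) → IsLadder F′ → F′ ≡ addRoots k d F₀
  unique F′ p L with F , F∈ , refl ← ∈-map⁻ (addRoots k d) p
    with h , s ← addRoots-IsLadder⁻ d k F L
    with refl ← trans (sym (+-identityʳ h)) (shape-size {j} F∈ s) =
    cong (addRoots k d) (plusForests-shape-unique {j} F∈ F₀∈ s s₀)
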